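{- Let $w \in \{1,2,3\}^{\mathbb{N}}$ be such that $\rho_w(n) \le 3$ for every positive integer $n$ and $w$ admits letter frequencies which are rationally independent. Let $\ell$ be a positive integer, and let $M_\ell \in \mathcal{M}_3(\mathbb{N})$ be the matrix whose columns are $\mathrm{ab}(u_1), \mathrm{ab}(u_2), \mathrm{ab}(u_3)$, where $u_1,u_2,u_3 \in \mathcal{L}_\ell(w)$ are representatives of the three abelian classes $\mathcal{L}_\ell(w)/\sim_{ab} = \{\bar u_1, \bar u_2, \bar u_3\}$, the induced alphabet $\mathcal{A}_\ell = \mathcal{L}_\ell(w)/\sim_{ab}$ being ordered as $(\bar u_1, \bar u_2, \bar u_3)$. Then: 1. For every positive integer $n$ and every $u \in \mathcal{L}_{n\ell}(w)$, $\mathrm{ab}(u) = M_\ell \cdot \mathrm{ab}(I_\ell(u))$. 2. If the letter frequencies of $I_\ell(w)$ exist, then $(f_w(i))_{i\in\{1,2,3\}} = \frac{1}{\ell} M_\ell \cdot (f_{I_\ell(w)}(a))_{a \in \mathcal{A}_\ell}$. 3. $M_\ell \in \mathrm{GL}_3(\mathbb{Q})$. 4. The letter frequencies of $I_\ell(w)$ exist and are rationally independent. 5. $\rho_{I_\ell(w)}(n) = 3$ for every positive integer $n$.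
   Context: For an infinite word $w$, $\mathcal{L}_n(w)$ is the set of its length-$n$ factors (contiguous subwords), $|u|_i$ counts occurrences of the letter $i$ in a finite word $u$, $\mathrm{pref}_n(w)$ is the length-$n$ prefix, and letter frequencies are $f_w(i) = \lim_n |\mathrm{pref}_n(w)|_i/n$; rationally independent means linearly independent over $\mathbb{Q}$. The abelianized vector of a finite word $u$ over an ordered alphabet $\mathcal{A}$ is the column vector $\mathrm{ab}(u) = (|u|_a)_{a\in\mathcal{A}}$. Two finite words are abelian equivalent ($\sim_{ab}$) if they have the same abelianized vector; $\bar u$ denotes the class of $u$. $\rho_w(n) = \mathrm{card}(\mathcal{L}_n(w)/\sim_{ab})$ for $n\ge1$. For $\ell \geq 1$, the abelian induced word $I_\ell(w)$ is the infinite word over $\mathcal{A}_\ell = \mathcal{L}_\ell(w)/\sim_{ab}$ with $I_\ell(w)[n] = \overline{w[n\ell:(n+1)\ell-1]}$ ($w[p:q]$ being the factor from position $p$ to $q$ inclusive); for a finite factor $u$ of length $n\ell$, $I_\ell(u)$ is the length-$n$ word over $\mathcal{A}_\ell$ whose $m$-th letter is the abelian class of the $m$-th consecutive block of length $\ell$ of $u$. -}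

module Defs where

open import Data.Nat as ℕ using (ℕ; zero; suc; _+_; _*_; _≤_; NonZero)
open import Data.Fin using (Fin; zero; suc)
open import Data.Bool using (Bool; true; false; if_then_else_; _∧_)
open import Data.Product using (Σ; ∃; _×_; _,_)
open import Data.Sum using (_⊎_)
open import Data.Integer using (ℤ; +_)
open import Data.Rational as ℚ using (ℚ; 0ℚ; 1ℚ)
open import Relation.Binary.PropositionalEquality using (_≡_; _≢_)
open import Relation.Nullary using (¬_)
open import Relation.Nullary.Decidable using (⌊_⌋)

-- Infinite words over the ordered 3-letter alphabet {1,2,3}, encoded as Fin 3
-- (letter 1 ↦ zero, 2 ↦ suc zero, 3 ↦ suc (suc zero)); positions start at 0.
Word : Set
Word = ℕ → Fin 3

eqF : Fin 3 → Fin 3 → Bool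
eqF a b = ⌊ a Data.Fin.≟ b ⌋

count : Word → ℕ → ℕ → Fin 3 → ℕ
count w p zero    a = 0
count w p (suc n) a = (if eqF (w p) a then 1 else 0) + count w (suc p) n a

AbEq : Word → ℕ → ℕ → ℕ → Set
AbEq w n p q = ∀ a → count w p n a ≡ count w q n a

abEqᵇ : Word → ℕ → ℕ → ℕ → Bool
abEqᵇ w n p q =
  ⌊ count w p n zero ℕ.≟ count w q n zero ⌋ ∧
  (⌊ count w p n (suc zero) ℕ.≟ count w q n (suc zero) ⌋ ∧
   ⌊ count w p n (suc (suc zero)) ℕ.≟ count w q n (suc (suc zero)) ⌋)

-- ρ_w(n) ≤ 3 : at most three abelian classes among the length-n factors,
-- i.e. there are (not necessarily distinct) factors at p₁ p₂ p₃ such that every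
-- length-n factor is abelian equivalent to one of them.
RhoLe3 : Word → ℕ → Set
RhoLe3 w n = Σ ℕ λ p₁ → Σ ℕ λ p₂ → Σ ℕ λ p₃ →
  ∀ q → AbEq w n q p₁ ⊎ AbEq w n q p₂ ⊎ AbEq w n q p₃

Reps3 : Word → ℕ → ℕ → ℕ → ℕ → Set
Reps3 w n p₁ p₂ p₃ =
  ¬ AbEq w n p₁ p₂ × ¬ AbEq w n p₁ p₃ × ¬ AbEq w n p₂ p₃ ×
  (∀ q → AbEq w n q p₁ ⊎ AbEq w n q p₂ ⊎ AbEq w n q p₃)

Rho≡3 : Word → ℕ → Set
Rho≡3 w n = Σ ℕ λ p₁ → Σ ℕ λ p₂ → Σ ℕ λ p₃ → Reps3 w n p₁ p₂ p₃

-- Index (in the ordered alphabet A_ℓ = (ū₁,ū₂,ū₃)) of the abelian class of the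
-- length-ℓ factor at position q, where uₖ is the factor at position pₖ.
classOf : Word → ℕ → ℕ → ℕ → ℕ → ℕ → Fin 3
classOf w ℓ p₁ p₂ p₃ q =
  if abEqᵇ w ℓ q p₁ then zero
  else if abEqᵇ w ℓ q p₂ then suc zero
  else suc (suc zero)

-- I_ℓ of the factor of w starting at position p (cut into consecutive blocks of
-- length ℓ), as an infinite word over A_ℓ ≅ Fin 3.  The abelian induced word
-- I_ℓ(w) is inducedFrom … 0; I_ℓ(w[p : p+nℓ-1]) is the length-n prefix of
-- inducedFrom … p.
inducedFrom : Word → ℕ → ℕ → ℕ → ℕ → ℕ → Word
inducedFrom w ℓ p₁ p₂ p₃ p m = classOf w ℓ p₁ p₂ p₃ (p + m * ℓ)

induced : Word → ℕ → ℕ → ℕ → ℕ → Word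
induced w ℓ p₁ p₂ p₃ = inducedFrom w ℓ p₁ p₂ p₃ 0

Matℕ : Set
Matℕ = Fin 3 → Fin 3 → ℕ

Matℚ : Set
Matℚ = Fin 3 → Fin 3 → ℚ

Mell : Word → ℕ → ℕ → ℕ → ℕ → Matℕ
Mell w ℓ p₁ p₂ p₃ i zero             = count w p₁ ℓ i
Mell w ℓ p₁ p₂ p₃ i (suc zero)       = count w p₂ ℓ i
Mell w ℓ p₁ p₂ p₃ i (suc (suc zero)) = count w p₃ ℓ i

mulVecℕ : Matℕ → (Fin 3 → ℕ) → Fin 3 → ℕ
mulVecℕ M v i = M i zero * v zero + M i (suc zero) * v (suc zero)
              + M i (suc (suc zero)) * v (suc (suc zero))

mulVecℚ : Matℚ → (Fin 3 → ℚ) → Fin 3 → ℚ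
mulVecℚ M v i = M i zero ℚ.* v zero ℚ.+ M i (suc zero) ℚ.* v (suc zero)
              ℚ.+ M i (suc (suc zero)) ℚ.* v (suc (suc zero))

mulMat : Matℚ → Matℚ → Matℚ
mulMat M N i j = mulVecℚ M (λ k → N k j) i

idMat : Matℚ
idMat i j = if eqF i j then 1ℚ else 0ℚ

toℚMat : Matℕ → Matℚ
toℚMat M i j = + M i j ℚ./ 1

InGL3ℚ : Matℚ → Set
InGL3ℚ M = Σ Matℚ λ N → (∀ i j → mulMat M N i j ≡ idMat i j)
                      × (∀ i j → mulMat N M i j ≡ idMat i j)

-- The sequence |pref_{n+1}(w)|_a / (n+1), n ≥ 0 (whose limit is f_w(a)).
freqSeq : Word → Fin 3 → ℕ → ℚ
freqSeq w a n = + count w 0 (suc n) a ℚ./ suc n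

-- A rational sequence converges (in ℝ), via the Cauchy criterion.
Converges : (ℕ → ℚ) → Set
Converges s = ∀ (ε : ℚ) → 0ℚ ℚ.< ε →
  Σ ℕ λ N → ∀ m n → N ≤ m → N ≤ n → ℚ.∣ s m ℚ.- s n ∣ ℚ.< ε

SameLimit : (ℕ → ℚ) → (ℕ → ℚ) → Set
SameLimit s t = ∀ (ε : ℚ) → 0ℚ ℚ.< ε →
  Σ ℕ λ N → ∀ n → N ≤ n → ℚ.∣ s n ℚ.- t n ∣ ℚ.< ε

HasFreqs : Word → Set
HasFreqs w = ∀ a → Converges (freqSeq w a)

-- The (existing) letter frequencies of w are rationally independent: for every
-- nonzero rational coefficient vector c, the limit Σ c_a f_w(a) is ≠ 0, in the
-- constructive (apartness) sense: the approximating sequence is eventually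
-- bounded away from 0.
RatIndep : Word → Set
RatIndep w = ∀ (c : Fin 3 → ℚ) → (Σ (Fin 3) λ a → c a ≢ 0ℚ) →
  Σ ℚ λ ε → 0ℚ ℚ.< ε × Σ ℕ λ N → ∀ n → N ≤ n →
    ε ℚ.≤ ℚ.∣ c zero ℚ.* freqSeq w zero n
             ℚ.+ c (suc zero) ℚ.* freqSeq w (suc zero) n
             ℚ.+ c (suc (suc zero)) ℚ.* freqSeq w (suc (suc zero)) n ∣

{-# OPTIONS --safe #-}
module Submission where

-- Cutting a factor of length nℓ into n blocks of length ℓ and replacing every block by the
-- column of M_ℓ of its abelian class gives ab(u) = M_ℓ · ab(I_ℓ(u)); dividing by the length
-- relates the frequencies of w along prefix lengths that are multiples of ℓ to those of I_ℓ(w).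
--
-- M_ℓ is invertible: its first two columns are distinct with the same coordinate sum ℓ, so
-- their cross product c is nonzero and orthogonal to both.  If det M_ℓ = 0, c is orthogonal to
-- the third column as well, hence to every factor of length ℓ and to every prefix of length kℓ,
-- which rational independence of the frequencies of w forbids.
--
-- With N = M_ℓ⁻¹, the frequencies of I_ℓ(w) are ℓ N applied to those of w, so they exist, and
-- c · f_I = ℓ (Nᵀ c) · f_w makes them rationally independent.  Independence yields, for every n,
-- three pairwise inequivalent factors of I_ℓ(w) of length n, and four would give, since M_ℓ is
-- injective, four pairwise inequivalent factors of w of length nℓ.

open import Defs
open import Level using (0ℓ)
open import Function using (_∘_; id)
open import Data.Bool using (true; false; if_then_else_)
open import Data.Empty using (⊥-elim)
open import Data.Nat using (ℕ; zero; suc; _≤_; NonZero; z≤n; s≤s)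
import Data.Nat as ℕ
import Data.Nat.Properties as ℕₚ
open import Data.Nat.Tactic.RingSolver using () renaming (solve to solve-ℕ)
open import Data.Fin as Fin using (Fin; zero; suc)
open import Data.Fin.Patterns using (0F; 1F; 2F)
import Data.Fin.Properties as Finₚ
open import Data.Integer as ℤ using (ℤ; +_)
import Data.Integer.Properties as ℤₚ
open import Data.Rational as ℚ using (ℚ; 0ℚ; 1ℚ; ½; _+_; _*_; _-_; -_; 1/_; _÷_; ∣_∣; _/_)
import Data.Rational.Properties as ℚₚ
open import Data.Rational.Unnormalised as ℚᵘ using (mkℚᵘ; *≡*)
import Data.Rational.Unnormalised.Properties as ℚᵘₚ
open import Data.Product using (Σ; ∃-syntax; _×_; _,_; proj₁; proj₂)
open import Data.Sum using (_⊎_; inj₁; inj₂; [_,_]′)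
open import Data.List using (_∷_; [])
open import Data.Vec using (Vec; lookup)
open import Data.Vec.Relation.Unary.AllPairs using (AllPairs)
import Data.Vec.Relation.Unary.All as All
open import Data.Vec.Relation.Unary.All.Properties using (lookup⁺)
open import Relation.Nullary using (¬_; Dec; yes; no; contradiction)
open import Relation.Nullary.Decidable using (dec⇒maybe)
open import Relation.Binary.PropositionalEquality
open import Tactic.RingSolver using (solve)
import Tactic.RingSolver.Core.AlmostCommutativeRing as ACR

-- Rational arithmetic

ℚ-ring : ACR.AlmostCommutativeRing 0ℓ 0ℓ
ℚ-ring = ACR.fromCommutativeRing ℚₚ.+-*-commutativeRing (λ q → dec⇒maybe (0ℚ ℚₚ.≟ q))

*-÷-cancelʳ : ∀ p r .{{_ : ℚ.NonZero r}} → p * r ÷ r ≡ p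
*-÷-cancelʳ p r = begin
  p * r * 1/ r   ≡⟨ ℚₚ.*-assoc p r (1/ r) ⟩
  p * (r * 1/ r) ≡⟨ cong (p *_) (ℚₚ.*-inverseʳ r) ⟩
  p * 1ℚ         ≡⟨ ℚₚ.*-identityʳ p ⟩
  p              ∎
  where open ≡-Reasoning

÷-*-cancelʳ : ∀ p r .{{_ : ℚ.NonZero r}} → p ÷ r * r ≡ p
÷-*-cancelʳ p r = begin
  p * 1/ r * r   ≡⟨ ℚₚ.*-assoc p (1/ r) r ⟩
  p * (1/ r * r) ≡⟨ cong (p *_) (ℚₚ.*-inverseˡ r) ⟩
  p * 1ℚ         ≡⟨ ℚₚ.*-identityʳ p ⟩
  p              ∎
  where open ≡-Reasoning

*-cancelʳ-≡ : ∀ {p q} r .{{_ : ℚ.NonZero r}} → p * r ≡ q * r → p ≡ q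
*-cancelʳ-≡ {p} {q} r eq = begin
  p           ≡⟨ *-÷-cancelʳ p r ⟨
  p * r ÷ r   ≡⟨ cong (λ x → x ÷ r) eq ⟩
  q * r ÷ r   ≡⟨ *-÷-cancelʳ q r ⟩
  q           ∎
  where open ≡-Reasoning

∣p∣≤∣q*p∣ : ∀ {q} p → 1ℚ ℚ.≤ q → ∣ p ∣ ℚ.≤ ∣ q * p ∣
∣p∣≤∣q*p∣ {q} p 1≤q = begin
  ∣ p ∣          ≡⟨ ℚₚ.*-identityˡ ∣ p ∣ ⟨
  1ℚ * ∣ p ∣     ≤⟨ ℚₚ.*-monoʳ-≤-nonNeg ∣ p ∣ {{ℚₚ.∣-∣-nonNeg p}} 1≤q ⟩
  q * ∣ p ∣      ≡⟨ cong (_* ∣ p ∣) (ℚₚ.0≤p⇒∣p∣≡p (ℚₚ.≤-trans (ℚₚ.nonNegative⁻¹ 1ℚ) 1≤q)) ⟨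
  ∣ q ∣ * ∣ p ∣  ≡⟨ ℚₚ.∣p*q∣≡∣p∣*∣q∣ q p ⟨
  ∣ q * p ∣      ∎
  where open ℚₚ.≤-Reasoning

-- ι is kept opaque: unfolding n / 1 exposes a gcd normalisation that makes
-- conversion checking and with-abstraction over ι-terms very slow.
opaque
  ι : ℕ → ℚ
  ι n = + n / 1

  ι-def : ∀ n → ι n ≡ + n / 1
  ι-def n = refl

  ι-0 : ι 0 ≡ 0ℚ
  ι-0 = refl

  ι-1 : ι 1 ≡ 1ℚ
  ι-1 = refl

  private
    toℚᵘ-/ : ∀ i d → ℚ.toℚᵘ (i / suc d) ℚᵘ.≃ mkℚᵘ i d
    toℚᵘ-/ i d = ℚₚ.toℚᵘ-fromℚᵘ (mkℚᵘ i d)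

    toℚᵘ-ι : ∀ n → ℚ.toℚᵘ (ι n) ℚᵘ.≃ mkℚᵘ (+ n) 0
    toℚᵘ-ι n = toℚᵘ-/ (+ n) 0

  ι-+ : ∀ m n → ι (m ℕ.+ n) ≡ ι m + ι n
  ι-+ m n = ℚₚ.toℚᵘ-injective (begin
    ℚ.toℚᵘ (ι (m ℕ.+ n))                ≈⟨ toℚᵘ-ι (m ℕ.+ n) ⟩
    mkℚᵘ (+ (m ℕ.+ n)) 0                ≈⟨ *≡* (cong (ℤ._* + 1) (trans (ℤₚ.pos-+ m n)
                                           (sym (cong₂ ℤ._+_ (ℤₚ.*-identityʳ (+ m)) (ℤₚ.*-identityʳ (+ n)))))) ⟩
    mkℚᵘ (+ m) 0 ℚᵘ.+ mkℚᵘ (+ n) 0      ≈⟨ ℚᵘₚ.+-cong (toℚᵘ-ι m) (toℚᵘ-ι n) ⟨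
    ℚ.toℚᵘ (ι m) ℚᵘ.+ ℚ.toℚᵘ (ι n)      ≈⟨ ℚₚ.toℚᵘ-homo-+ (ι m) (ι n) ⟨
    ℚ.toℚᵘ (ι m + ι n)                  ∎)
    where open ℚᵘₚ.≃-Reasoning

  ι-* : ∀ m n → ι (m ℕ.* n) ≡ ι m * ι n
  ι-* m n = ℚₚ.toℚᵘ-injective (begin
    ℚ.toℚᵘ (ι (m ℕ.* n))                ≈⟨ toℚᵘ-ι (m ℕ.* n) ⟩
    mkℚᵘ (+ (m ℕ.* n)) 0                ≈⟨ *≡* (cong (ℤ._* + 1) (ℤₚ.pos-* m n)) ⟩
    mkℚᵘ (+ m) 0 ℚᵘ.* mkℚᵘ (+ n) 0      ≈⟨ ℚᵘₚ.*-cong (toℚᵘ-ι m) (toℚᵘ-ι n) ⟨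
    ℚ.toℚᵘ (ι m) ℚᵘ.* ℚ.toℚᵘ (ι n)      ≈⟨ ℚₚ.toℚᵘ-homo-* (ι m) (ι n) ⟨
    ℚ.toℚᵘ (ι m * ι n)                  ∎)
    where open ℚᵘₚ.≃-Reasoning

  ι-injective : ∀ {m n} → ι m ≡ ι n → m ≡ n
  ι-injective {m} {n} eq
    with *≡* e ← ℚᵘₚ.≃-trans (ℚᵘₚ.≃-sym (toℚᵘ-ι m)) (ℚᵘₚ.≃-trans (ℚₚ.toℚᵘ-cong eq) (toℚᵘ-ι n))
    = ℤₚ.+-injective (trans (sym (ℤₚ.*-identityʳ _)) (trans e (ℤₚ.*-identityʳ _)))

  1≤ι-suc : ∀ n → 1ℚ ℚ.≤ ι (suc n)
  1≤ι-suc n = begin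
    1ℚ          ≡⟨ ℚₚ.+-identityʳ 1ℚ ⟨
    1ℚ + 0ℚ     ≤⟨ ℚₚ.+-monoʳ-≤ 1ℚ (ℚₚ.nonNegative⁻¹ (ι n) {{ℚₚ.normalize-nonNeg n 1}}) ⟩
    1ℚ + ι n    ≡⟨ ι-+ 1 n ⟨
    ι (suc n)   ∎
    where open ℚₚ.≤-Reasoning

  /-*-cancelʳ : ∀ m n → + m / suc n * ι (suc n) ≡ ι m
  /-*-cancelʳ m n = ℚₚ.toℚᵘ-injective (begin
    ℚ.toℚᵘ (+ m / suc n * ι (suc n))                   ≈⟨ ℚₚ.toℚᵘ-homo-* (+ m / suc n) (ι (suc n)) ⟩
    ℚ.toℚᵘ (+ m / suc n) ℚᵘ.* ℚ.toℚᵘ (ι (suc n))       ≈⟨ ℚᵘₚ.*-cong (toℚᵘ-/ (+ m) n) (toℚᵘ-ι (suc n)) ⟩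
    mkℚᵘ (+ m) n ℚᵘ.* mkℚᵘ (+ suc n) 0                 ≈⟨ *≡* (trans (ℤₚ.*-identityʳ _)
                                                            (cong (λ d → + m ℤ.* + d) (sym (ℕₚ.*-identityʳ _)))) ⟩
    mkℚᵘ (+ m) 0                                       ≈⟨ toℚᵘ-ι m ⟨
    ℚ.toℚᵘ (ι m)                                       ∎)
    where open ℚᵘₚ.≃-Reasoning

ι-suc≢0 : ∀ n → ι (suc n) ≢ 0ℚ
ι-suc≢0 n eq with () ← ι-injective {suc n} {0} (trans eq (sym ι-0))

ι-suc-nonZero : ∀ n → ℚ.NonZero (ι (suc n))
ι-suc-nonZero n = ℚ.≢-nonZero (ι-suc≢0 n)

-- Vectors and 3 × 3 matrices over ℚ

ℚ³ : Set
ℚ³ = Fin 3 → ℚ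

infix 8 _·_
_·_ : ℚ³ → ℚ³ → ℚ
u · v = u 0F * v 0F + u 1F * v 1F + u 2F * v 2F

total : ℚ³ → ℚ
total u = u 0F + u 1F + u 2F

transpose : Matℚ → Matℚ
transpose M i j = M j i

-- Abstracting over the coordinates turns them into the variables that solve expects.
·-comm : ∀ u v → u · v ≡ v · u
·-comm u v with u 0F | u 1F | u 2F | v 0F | v 1F | v 2F
... | u₀ | u₁ | u₂ | v₀ | v₁ | v₂ = solve (u₀ ∷ u₁ ∷ u₂ ∷ v₀ ∷ v₁ ∷ v₂ ∷ []) ℚ-ring

·-congˡ : ∀ {u u′} v → u ≗ u′ → u · v ≡ u′ · v
·-congˡ v eq =
  cong₂ _+_ (cong₂ _+_ (cong (_* v 0F) (eq 0F)) (cong (_* v 1F) (eq 1F))) (cong (_* v 2F) (eq 2F))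

·-congʳ : ∀ u {v v′} → v ≗ v′ → u · v ≡ u · v′
·-congʳ u eq =
  cong₂ _+_ (cong₂ _+_ (cong (u 0F *_) (eq 0F)) (cong (u 1F *_) (eq 1F))) (cong (u 2F *_) (eq 2F))

·-zeroˡ : ∀ v → (λ _ → 0ℚ) · v ≡ 0ℚ
·-zeroˡ v with v 0F | v 1F | v 2F
... | v₀ | v₁ | v₂ = solve (v₀ ∷ v₁ ∷ v₂ ∷ []) ℚ-ring

·-+ʳ : ∀ u v w → u · (λ a → v a + w a) ≡ u · v + u · w
·-+ʳ u v w with u 0F | u 1F | u 2F | v 0F | v 1F | v 2F | w 0F | w 1F | w 2F
... | u₀ | u₁ | u₂ | v₀ | v₁ | v₂ | w₀ | w₁ | w₂ =
  solve (u₀ ∷ u₁ ∷ u₂ ∷ v₀ ∷ v₁ ∷ v₂ ∷ w₀ ∷ w₁ ∷ w₂ ∷ []) ℚ-ring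

·-*ˡ : ∀ t u v → u · (λ a → t * v a) ≡ t * (u · v)
·-*ˡ t u v with u 0F | u 1F | u 2F | v 0F | v 1F | v 2F
... | u₀ | u₁ | u₂ | v₀ | v₁ | v₂ = solve (t ∷ u₀ ∷ u₁ ∷ u₂ ∷ v₀ ∷ v₁ ∷ v₂ ∷ []) ℚ-ring

·-*ʳ : ∀ t u v → u · (λ a → v a * t) ≡ u · v * t
·-*ʳ t u v with u 0F | u 1F | u 2F | v 0F | v 1F | v 2F
... | u₀ | u₁ | u₂ | v₀ | v₁ | v₂ = solve (t ∷ u₀ ∷ u₁ ∷ u₂ ∷ v₀ ∷ v₁ ∷ v₂ ∷ []) ℚ-ring

·-mulVec : ∀ c M u → c · mulVecℚ M u ≡ mulVecℚ (transpose M) c · u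
·-mulVec c M u
  with c 0F | c 1F | c 2F | u 0F | u 1F | u 2F
     | M 0F 0F | M 0F 1F | M 0F 2F | M 1F 0F | M 1F 1F | M 1F 2F | M 2F 0F | M 2F 1F | M 2F 2F
... | c₀ | c₁ | c₂ | u₀ | u₁ | u₂ | m₀₀ | m₀₁ | m₀₂ | m₁₀ | m₁₁ | m₁₂ | m₂₀ | m₂₁ | m₂₂ =
  solve (c₀ ∷ c₁ ∷ c₂ ∷ u₀ ∷ u₁ ∷ u₂ ∷ m₀₀ ∷ m₀₁ ∷ m₀₂ ∷ m₁₀ ∷ m₁₁ ∷ m₁₂ ∷ m₂₀ ∷ m₂₁ ∷ m₂₂ ∷ []) ℚ-ring

·-idMat : ∀ i u → u · (λ k → idMat k i) ≡ u i
·-idMat 0F u with u 0F | u 1F | u 2F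
... | u₀ | u₁ | u₂ = solve (u₀ ∷ u₁ ∷ u₂ ∷ []) ℚ-ring
·-idMat 1F u with u 0F | u 1F | u 2F
... | u₀ | u₁ | u₂ = solve (u₀ ∷ u₁ ∷ u₂ ∷ []) ℚ-ring
·-idMat 2F u with u 0F | u 1F | u 2F
... | u₀ | u₁ | u₂ = solve (u₀ ∷ u₁ ∷ u₂ ∷ []) ℚ-ring

total-cong : ∀ {u v} → u ≗ v → total u ≡ total v
total-cong u≗v = cong₂ _+_ (cong₂ _+_ (u≗v 0F) (u≗v 1F)) (u≗v 2F)

nonzero-coordinate : ∀ (c : ℚ³) → ¬ (∀ a → c a ≡ 0ℚ) → ∃[ a ] c a ≢ 0ℚ
nonzero-coordinate c = Finₚ.¬∀⟶∃¬ 3 (λ a → c a ≡ 0ℚ) (λ a → c a ℚₚ.≟ 0ℚ)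

∃-nonzero-orthogonal : ∀ u → total u ≢ 0ℚ → Σ ℚ³ λ c → (∃[ a ] c a ≢ 0ℚ) × c · u ≡ 0ℚ
∃-nonzero-orthogonal u Σu≢0 = c , nonzero-coordinate c c≢0 , c⊥u
  where
  c : ℚ³
  c 0F = total u - u 0F
  c 1F = - u 0F
  c 2F = - u 0F
  c⊥u : c · u ≡ 0ℚ
  c⊥u with u 0F | u 1F | u 2F
  ... | u₀ | u₁ | u₂ = solve (u₀ ∷ u₁ ∷ u₂ ∷ []) ℚ-ring
  c≢0 : ¬ (∀ a → c a ≡ 0ℚ)
  c≢0 c≗0 = Σu≢0 (begin
    total u              ≡⟨ ℚₚ.+-identityʳ (total u) ⟨
    total u - 0ℚ         ≡⟨ cong (λ y → total u - y) (ℚₚ.neg-injective {u 0F} {0ℚ} (c≗0 1F)) ⟨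
    total u - u 0F       ≡⟨ c≗0 0F ⟩
    0ℚ                   ∎)
    where open ≡-Reasoning

idMat-sym : ∀ i k → idMat i k ≡ idMat k i
idMat-sym i k with i Fin.≟ k | k Fin.≟ i
... | yes _   | yes _   = refl
... | no _    | no _    = refl
... | yes i≡k | no k≢i  = ⊥-elim (k≢i (sym i≡k))
... | no i≢k  | yes k≡i = ⊥-elim (i≢k (sym k≡i))

mulVec-idMat : ∀ u i → mulVecℚ idMat u i ≡ u i
mulVec-idMat u i = begin
  idMat i · u               ≡⟨ ·-comm (idMat i) u ⟩
  u · idMat i               ≡⟨ ·-congʳ u (idMat-sym i) ⟩
  u · (λ k → idMat k i)     ≡⟨ ·-idMat i u ⟩
  u i                       ∎
  where open ≡-Reasoning

mulVec-leftInverse : ∀ N M → (∀ i j → mulMat N M i j ≡ idMat i j) →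
                     ∀ u i → mulVecℚ N (mulVecℚ M u) i ≡ u i
mulVec-leftInverse N M NM≡I u i = begin
  N i · mulVecℚ M u                 ≡⟨ ·-mulVec (N i) M u ⟩
  mulVecℚ (transpose M) (N i) · u   ≡⟨ ·-congˡ u (λ j → trans (·-comm (transpose M j) (N i)) (NM≡I i j)) ⟩
  idMat i · u                       ≡⟨ mulVec-idMat u i ⟩
  u i                               ∎
  where open ≡-Reasoning

mulVec-injective : ∀ N M → (∀ i j → mulMat N M i j ≡ idMat i j) →
                   ∀ {u v} → mulVecℚ M u ≗ mulVecℚ M v → u ≗ v
mulVec-injective N M NM≡I {u} {v} Mu≗Mv i = begin
  u i                          ≡⟨ mulVec-leftInverse N M NM≡I u i ⟨
  N i · mulVecℚ M u            ≡⟨ ·-congʳ (N i) Mu≗Mv ⟩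
  N i · mulVecℚ M v            ≡⟨ mulVec-leftInverse N M NM≡I v i ⟩
  v i                          ∎
  where open ≡-Reasoning

_⁺ : Fin 3 → Fin 3
0F ⁺ = 1F
1F ⁺ = 2F
2F ⁺ = 0F

cross : ℚ³ → ℚ³ → ℚ³
cross u v a = u (a ⁺) * v (a ⁺ ⁺) - u (a ⁺ ⁺) * v (a ⁺)

cross-orthˡ : ∀ u v → cross u v · u ≡ 0ℚ
cross-orthˡ u v with u 0F | u 1F | u 2F | v 0F | v 1F | v 2F
... | u₀ | u₁ | u₂ | v₀ | v₁ | v₂ = solve (u₀ ∷ u₁ ∷ u₂ ∷ v₀ ∷ v₁ ∷ v₂ ∷ []) ℚ-ring

cross-orthʳ : ∀ u v → cross u v · v ≡ 0ℚ
cross-orthʳ u v with u 0F | u 1F | u 2F | v 0F | v 1F | v 2F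
... | u₀ | u₁ | u₂ | v₀ | v₁ | v₂ = solve (u₀ ∷ u₁ ∷ u₂ ∷ v₀ ∷ v₁ ∷ v₂ ∷ []) ℚ-ring

cross-cyclic : ∀ u v w → cross u v · w ≡ cross v w · u
cross-cyclic u v w with u 0F | u 1F | u 2F | v 0F | v 1F | v 2F | w 0F | w 1F | w 2F
... | u₀ | u₁ | u₂ | v₀ | v₁ | v₂ | w₀ | w₁ | w₂ =
  solve (u₀ ∷ u₁ ∷ u₂ ∷ v₀ ∷ v₁ ∷ v₂ ∷ w₀ ∷ w₁ ∷ w₂ ∷ []) ℚ-ring

-- By the identity  u a * total v = v a * total u + (cross u v (a ⁺ ⁺) - cross u v (a ⁺)).
cross≗0⇒≗ : ∀ {u v} → (∀ a → cross u v a ≡ 0ℚ) → total u ≡ total v → total u ≢ 0ℚ → u ≗ v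
cross≗0⇒≗ {u} {v} u×v≗0 Σu≡Σv Σu≢0 a = *-cancelʳ-≡ (total u) (begin
  u a * total u                                        ≡⟨ cong (u a *_) Σu≡Σv ⟩
  u a * total v                                        ≡⟨ identity a ⟩
  v a * total u + (cross u v (a ⁺ ⁺) - cross u v (a ⁺))
    ≡⟨ cong (λ x → v a * total u + x) (cong₂ _-_ (u×v≗0 (a ⁺ ⁺)) (u×v≗0 (a ⁺))) ⟩
  v a * total u + (0ℚ - 0ℚ)                            ≡⟨ ℚₚ.+-identityʳ (v a * total u) ⟩
  v a * total u                                        ∎)
  where
  open ≡-Reasoning
  instance _ = ℚ.≢-nonZero Σu≢0
  identity : ∀ a → u a * total v ≡ v a * total u + (cross u v (a ⁺ ⁺) - cross u v (a ⁺))
  identity 0F with u 0F | u 1F | u 2F | v 0F | v 1F | v 2F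
  ... | u₀ | u₁ | u₂ | v₀ | v₁ | v₂ = solve (u₀ ∷ u₁ ∷ u₂ ∷ v₀ ∷ v₁ ∷ v₂ ∷ []) ℚ-ring
  identity 1F with u 0F | u 1F | u 2F | v 0F | v 1F | v 2F
  ... | u₀ | u₁ | u₂ | v₀ | v₁ | v₂ = solve (u₀ ∷ u₁ ∷ u₂ ∷ v₀ ∷ v₁ ∷ v₂ ∷ []) ℚ-ring
  identity 2F with u 0F | u 1F | u 2F | v 0F | v 1F | v 2F
  ... | u₀ | u₁ | u₂ | v₀ | v₁ | v₂ = solve (u₀ ∷ u₁ ∷ u₂ ∷ v₀ ∷ v₁ ∷ v₂ ∷ []) ℚ-ring

det : Matℚ → ℚ
det M = cross (transpose M 0F) (transpose M 1F) · transpose M 2F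

det-transpose : ∀ M → det (transpose M) ≡ det M
det-transpose M with M 0F 0F | M 0F 1F | M 0F 2F | M 1F 0F | M 1F 1F | M 1F 2F | M 2F 0F | M 2F 1F | M 2F 2F
... | m₀₀ | m₀₁ | m₀₂ | m₁₀ | m₁₁ | m₁₂ | m₂₀ | m₂₁ | m₂₂ =
  solve (m₀₀ ∷ m₀₁ ∷ m₀₂ ∷ m₁₀ ∷ m₁₁ ∷ m₁₂ ∷ m₂₀ ∷ m₂₁ ∷ m₂₂ ∷ []) ℚ-ring

adj : Matℚ → Matℚ
adj M k = cross (transpose M (k ⁺)) (transpose M (k ⁺ ⁺))

adj-transpose : ∀ M k j → adj M k j ≡ adj (transpose M) j k
adj-transpose M k j =
  cong (λ x → M (j ⁺) (k ⁺) * M (j ⁺ ⁺) (k ⁺ ⁺) - x) (ℚₚ.*-comm (M (j ⁺ ⁺) (k ⁺)) (M (j ⁺) (k ⁺ ⁺)))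

module _ (M : Matℚ) where
  private
    c = transpose M

    diagonal : ∀ {x} → x ≡ det M → x ≡ 1ℚ * det M
    diagonal eq = trans eq (sym (ℚₚ.*-identityˡ (det M)))

    off-diagonal : ∀ {x} → x ≡ 0ℚ → x ≡ 0ℚ * det M
    off-diagonal eq = trans eq (sym (ℚₚ.*-zeroˡ (det M)))

  adj-mul : ∀ k j → adj M k · c j ≡ idMat k j * det M
  adj-mul 0F 0F = diagonal (sym (cross-cyclic (c 0F) (c 1F) (c 2F)))
  adj-mul 0F 1F = off-diagonal (cross-orthˡ (c 1F) (c 2F))
  adj-mul 0F 2F = off-diagonal (cross-orthʳ (c 1F) (c 2F))
  adj-mul 1F 0F = off-diagonal (cross-orthʳ (c 2F) (c 0F))
  adj-mul 1F 1F = diagonal (cross-cyclic (c 2F) (c 0F) (c 1F))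
  adj-mul 1F 2F = off-diagonal (cross-orthˡ (c 2F) (c 0F))
  adj-mul 2F 0F = off-diagonal (cross-orthˡ (c 0F) (c 1F))
  adj-mul 2F 1F = off-diagonal (cross-orthʳ (c 0F) (c 1F))
  adj-mul 2F 2F = diagonal refl

mul-adj : ∀ M i j → M i · (λ k → adj M k j) ≡ idMat i j * det M
mul-adj M i j = begin
  M i · (λ k → adj M k j)                 ≡⟨ ·-congʳ (M i) (λ k → adj-transpose M k j) ⟩
  M i · adj (transpose M) j               ≡⟨ ·-comm (M i) (adj (transpose M) j) ⟩
  adj (transpose M) j · M i               ≡⟨ adj-mul (transpose M) j i ⟩
  idMat j i * det (transpose M)           ≡⟨ cong₂ _*_ (idMat-sym j i) (det-transpose M) ⟩
  idMat i j * det M                       ∎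
  where open ≡-Reasoning

det≢0⇒InGL3ℚ : ∀ M → det M ≢ 0ℚ → InGL3ℚ M
det≢0⇒InGL3ℚ M det≢0 = N , MN≡I , NM≡I
  where
  open ≡-Reasoning
  instance _ = ℚ.≢-nonZero det≢0
  N : Matℚ
  N k j = adj M k j ÷ det M
  MN≡I : ∀ i j → mulMat M N i j ≡ idMat i j
  MN≡I i j = begin
    M i · (λ k → adj M k j ÷ det M)       ≡⟨ ·-*ʳ (1/ det M) (M i) (λ k → adj M k j) ⟩
    M i · (λ k → adj M k j) ÷ det M       ≡⟨ cong (_÷ det M) (mul-adj M i j) ⟩
    idMat i j * det M ÷ det M             ≡⟨ *-÷-cancelʳ (idMat i j) (det M) ⟩
    idMat i j                             ∎
  NM≡I : ∀ k j → mulMat N M k j ≡ idMat k j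
  NM≡I k j = begin
    N k · transpose M j                   ≡⟨ ·-comm (N k) (transpose M j) ⟩
    transpose M j · N k                   ≡⟨ ·-*ʳ (1/ det M) (transpose M j) (adj M k) ⟩
    transpose M j · adj M k ÷ det M       ≡⟨ cong (_÷ det M) (·-comm (transpose M j) (adj M k)) ⟩
    adj M k · transpose M j ÷ det M       ≡⟨ cong (_÷ det M) (adj-mul M k j) ⟩
    idMat k j * det M ÷ det M             ≡⟨ *-÷-cancelʳ (idMat k j) (det M) ⟩
    idMat k j                             ∎

-- Rational Cauchy sequences

Converges-cong : ∀ {s t} → s ≗ t → Converges s → Converges t
Converges-cong s≗t cauchy ε ε>0 with N , close ← cauchy ε ε>0 =
  N , λ m n m≥N n≥N → subst₂ (λ x y → ∣ x - y ∣ ℚ.< ε) (s≗t m) (s≗t n) (close m n m≥N n≥N)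

Converges-subsequence : ∀ {s} f → (∀ n → n ≤ f n) → Converges s → Converges (s ∘ f)
Converges-subsequence f n≤fn cauchy ε ε>0 with N , close ← cauchy ε ε>0 =
  N , λ m n m≥N n≥N → close (f m) (f n) (ℕₚ.≤-trans m≥N (n≤fn m)) (ℕₚ.≤-trans n≥N (n≤fn n))

Converges-+ : ∀ {s t} → Converges s → Converges t → Converges (λ n → s n + t n)
Converges-+ {s} {t} cauchy-s cauchy-t ε ε>0 = N₁ ℕ.⊔ N₂ , λ m n m≥N n≥N → begin-strict
    ∣ (s m + t m) - (s n + t n) ∣       ≡⟨ cong ∣_∣ (regroup (s m) (t m) (s n) (t n)) ⟩
    ∣ (s m - s n) + (t m - t n) ∣       ≤⟨ ℚₚ.∣p+q∣≤∣p∣+∣q∣ (s m - s n) (t m - t n) ⟩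
    ∣ s m - s n ∣ + ∣ t m - t n ∣       <⟨ ℚₚ.+-mono-< (close-s m n (≥N₁ m≥N) (≥N₁ n≥N))
                                                         (close-t m n (≥N₂ m≥N) (≥N₂ n≥N)) ⟩
    ε * ½ + ε * ½                       ≡⟨ halves ε ⟩
    ε                                   ∎
  where
  open ℚₚ.≤-Reasoning
  ½ε>0 : 0ℚ ℚ.< ε * ½
  ½ε>0 = ℚₚ.positive⁻¹ (ε * ½) {{ℚₚ.pos*pos⇒pos ε {{ℚ.positive ε>0}} ½}}
  N₁ = proj₁ (cauchy-s (ε * ½) ½ε>0)
  close-s = proj₂ (cauchy-s (ε * ½) ½ε>0)
  N₂ = proj₁ (cauchy-t (ε * ½) ½ε>0)
  close-t = proj₂ (cauchy-t (ε * ½) ½ε>0)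
  halves : ∀ x → x * ½ + x * ½ ≡ x
  halves x = solve (x ∷ []) ℚ-ring
  regroup : ∀ a b c d → (a + b) - (c + d) ≡ (a - c) + (b - d)
  regroup a b c d = solve (a ∷ b ∷ c ∷ d ∷ []) ℚ-ring
  ≥N₁ : ∀ {n} → N₁ ℕ.⊔ N₂ ≤ n → N₁ ≤ n
  ≥N₁ = ℕₚ.≤-trans (ℕₚ.m≤m⊔n N₁ N₂)
  ≥N₂ : ∀ {n} → N₁ ℕ.⊔ N₂ ≤ n → N₂ ≤ n
  ≥N₂ = ℕₚ.≤-trans (ℕₚ.m≤n⊔m N₁ N₂)

Converges-*ˡ : ∀ {s} q → Converges s → Converges (λ n → q * s n)
Converges-*ˡ {s} q cauchy ε ε>0 = N , λ m n m≥N n≥N → begin-strict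
    ∣ q * s m - q * s n ∣               ≡⟨ cong ∣_∣ (factor q (s m) (s n)) ⟩
    ∣ q * (s m - s n) ∣                 ≡⟨ ℚₚ.∣p*q∣≡∣p∣*∣q∣ q (s m - s n) ⟩
    ∣ q ∣ * ∣ s m - s n ∣               ≤⟨ ℚₚ.*-monoʳ-≤-nonNeg _ {{ℚₚ.∣-∣-nonNeg (s m - s n)}} ∣q∣≤r ⟩
    r * ∣ s m - s n ∣                   <⟨ ℚₚ.*-monoʳ-<-pos r (close m n m≥N n≥N) ⟩
    r * (ε ÷ r)                         ≡⟨ ℚₚ.*-comm r (ε ÷ r) ⟩
    ε ÷ r * r                           ≡⟨ ÷-*-cancelʳ ε r ⟩
    ε                                   ∎
  where
  open ℚₚ.≤-Reasoning
  r : ℚ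
  r = ∣ q ∣ + 1ℚ
  instance
    r-pos : ℚ.Positive r
    r-pos = ℚₚ.nonNeg+pos⇒pos ∣ q ∣ {{ℚₚ.∣-∣-nonNeg q}} 1ℚ
    r-nonZero : ℚ.NonZero r
    r-nonZero = ℚₚ.pos⇒nonZero r
  ε/r>0 : 0ℚ ℚ.< ε ÷ r
  ε/r>0 = ℚₚ.positive⁻¹ (ε ÷ r) {{ℚₚ.pos*pos⇒pos ε {{ℚ.positive ε>0}} (1/ r) {{ℚₚ.1/pos⇒pos r}}}}
  N = proj₁ (cauchy (ε ÷ r) ε/r>0)
  close = proj₂ (cauchy (ε ÷ r) ε/r>0)
  ∣q∣≤r : ∣ q ∣ ℚ.≤ r
  ∣q∣≤r = begin
    ∣ q ∣        ≡⟨ ℚₚ.+-identityʳ ∣ q ∣ ⟨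
    ∣ q ∣ + 0ℚ   ≤⟨ ℚₚ.+-monoʳ-≤ ∣ q ∣ (ℚₚ.nonNegative⁻¹ 1ℚ) ⟩
    r            ∎
  factor : ∀ a b c → a * b - a * c ≡ a * (b - c)
  factor a b c = solve (a ∷ b ∷ c ∷ []) ℚ-ring

Converges-· : ∀ c {s : Fin 3 → ℕ → ℚ} → (∀ a → Converges (s a)) → Converges (λ n → c · (λ a → s a n))
Converges-· c {s} conv =
  Converges-+ {λ n → c 0F * s 0F n + c 1F * s 1F n} {λ n → c 2F * s 2F n}
    (Converges-+ {λ n → c 0F * s 0F n} {λ n → c 1F * s 1F n}
      (Converges-*ˡ (c 0F) (conv 0F)) (Converges-*ˡ (c 1F) (conv 1F)))
    (Converges-*ˡ (c 2F) (conv 2F))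

SameLimit-congʳ : ∀ {s t t′} → t ≗ t′ → SameLimit s t → SameLimit s t′
SameLimit-congʳ {s} t≗t′ lim ε ε>0 with N , close ← lim ε ε>0 =
  N , λ n n≥N → subst (λ y → ∣ s n - y ∣ ℚ.< ε) (t≗t′ n) (close n n≥N)

Converges⇒SameLimit-subsequence : ∀ {s} f → (∀ n → n ≤ f n) → Converges s → SameLimit s (s ∘ f)
Converges⇒SameLimit-subsequence f n≤fn cauchy ε ε>0 with N , close ← cauchy ε ε>0 =
  N , λ n n≥N → close n (f n) n≥N (ℕₚ.≤-trans n≥N (n≤fn n))

-- Letter counts and abelian equivalence

indicator : Fin 3 → Fin 3 → ℕ
indicator b a = if eqF b a then 1 else 0

count-++ : ∀ x p m n a → count x p (m ℕ.+ n) a ≡ count x p m a ℕ.+ count x (p ℕ.+ m) n a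
count-++ x p zero    n a rewrite ℕₚ.+-identityʳ p = refl
count-++ x p (suc m) n a rewrite count-++ x (suc p) m n a | ℕₚ.+-suc p m =
  sym (ℕₚ.+-assoc (indicator (x p) a) (count x (suc p) m a) _)

count-cong : ∀ {x y} p q n a → (∀ m → x (p ℕ.+ m) ≡ y (q ℕ.+ m)) → count x p n a ≡ count y q n a
count-cong p q zero    a eq = refl
count-cong {x} {y} p q (suc n) a eq =
  cong₂ ℕ._+_ (cong (λ b → indicator b a) (shift (ℕₚ.+-identityʳ p) (ℕₚ.+-identityʳ q) (eq 0)))
              (count-cong (suc p) (suc q) n a λ m → shift (ℕₚ.+-suc p m) (ℕₚ.+-suc q m) (eq (suc m)))
  where
  shift : ∀ {i i′ j j′} → i ≡ i′ → j ≡ j′ → x i ≡ y j → x i′ ≡ y j′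
  shift refl refl eq = eq

count-total : ∀ x p n → count x p n 0F ℕ.+ count x p n 1F ℕ.+ count x p n 2F ≡ n
count-total x p zero = refl
count-total x p (suc n) with count-total x (suc p) n | x p
... | IH | 0F = cong suc IH
... | IH | 1F = trans (cong (ℕ._+ count x (suc p) n 2F) (ℕₚ.+-suc (count x (suc p) n 0F) _)) (cong suc IH)
... | IH | 2F = trans (ℕₚ.+-suc (count x (suc p) n 0F ℕ.+ count x (suc p) n 1F) _) (cong suc IH)

abEq? : ∀ x n p q → Dec (AbEq x n p q)
abEq? x n p q = Finₚ.all? (λ a → count x p n a ℕₚ.≟ count x q n a)

abEqᵇ-sound : ∀ x n p q → abEqᵇ x n p q ≡ true → AbEq x n p q
abEqᵇ-sound x n p q with count x p n 0F ℕₚ.≟ count x q n 0F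
                       | count x p n 1F ℕₚ.≟ count x q n 1F
                       | count x p n 2F ℕₚ.≟ count x q n 2F
... | yes e₀ | yes e₁ | yes e₂ = λ _ → λ { 0F → e₀ ; 1F → e₁ ; 2F → e₂ }
... | no _   | _      | _      = λ ()
... | yes _  | no _   | _      = λ ()
... | yes _  | yes _  | no _   = λ ()

abEqᵇ-complete : ∀ x n p q → AbEq x n p q → abEqᵇ x n p q ≡ true
abEqᵇ-complete x n p q p~q with count x p n 0F ℕₚ.≟ count x q n 0F
                              | count x p n 1F ℕₚ.≟ count x q n 1F
                              | count x p n 2F ℕₚ.≟ count x q n 2F
... | yes _ | yes _ | yes _ = refl
... | no ≢₀  | _     | _     = ⊥-elim (≢₀ (p~q 0F))
... | yes _ | no ≢₁  | _     = ⊥-elim (≢₁ (p~q 1F))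
... | yes _ | yes _ | no ≢₂  = ⊥-elim (≢₂ (p~q 2F))

ab : Word → ℕ → ℕ → ℚ³
ab x p n a = ι (count x p n a)

freqs : Word → ℕ → ℚ³
freqs x n a = freqSeq x a n

ab-++ : ∀ x p m n a → ab x p (m ℕ.+ n) a ≡ ab x p m a + ab x (p ℕ.+ m) n a
ab-++ x p m n a = trans (cong ι (count-++ x p m n a)) (ι-+ (count x p m a) (count x (p ℕ.+ m) n a))

total-ab : ∀ x p n → total (ab x p n) ≡ ι n
total-ab x p n = begin
  ι c₀ + ι c₁ + ι c₂             ≡⟨ cong (_+ ι c₂) (ι-+ c₀ c₁) ⟨
  ι (c₀ ℕ.+ c₁) + ι c₂           ≡⟨ ι-+ (c₀ ℕ.+ c₁) c₂ ⟨
  ι (c₀ ℕ.+ c₁ ℕ.+ c₂)           ≡⟨ cong ι (count-total x p n) ⟩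
  ι n                            ∎
  where
  open ≡-Reasoning
  c₀ = count x p n 0F
  c₁ = count x p n 1F
  c₂ = count x p n 2F

AbEq⇒ab≗ : ∀ {x n p q} → AbEq x n p q → ab x p n ≗ ab x q n
AbEq⇒ab≗ p~q a = cong ι (p~q a)

ab≗⇒AbEq : ∀ {x n p q} → ab x p n ≗ ab x q n → AbEq x n p q
ab≗⇒AbEq eq a = ι-injective (eq a)

·-freqs : ∀ c x n → c · freqs x n * ι (suc n) ≡ c · ab x 0 (suc n)
·-freqs c x n = begin
  c · freqs x n * ι (suc n)                  ≡⟨ ·-*ʳ (ι (suc n)) c (freqs x n) ⟨
  c · (λ a → freqSeq x a n * ι (suc n))      ≡⟨ ·-congʳ c (λ a → /-*-cancelʳ (count x 0 (suc n) a) n) ⟩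
  c · ab x 0 (suc n)                         ∎
  where open ≡-Reasoning

mulVecℕ-cong : ∀ M i {u v} → u ≗ v → mulVecℕ M u i ≡ mulVecℕ M v i
mulVecℕ-cong M i u≗v = cong₂ ℕ._+_
  (cong₂ ℕ._+_ (cong (M i 0F ℕ.*_) (u≗v 0F)) (cong (M i 1F ℕ.*_) (u≗v 1F))) (cong (M i 2F ℕ.*_) (u≗v 2F))

mulVecℕ-+ : ∀ M u v i → mulVecℕ M (λ a → u a ℕ.+ v a) i ≡ mulVecℕ M u i ℕ.+ mulVecℕ M v i
mulVecℕ-+ M u v i with M i 0F | M i 1F | M i 2F | u 0F | u 1F | u 2F | v 0F | v 1F | v 2F
... | m₀ | m₁ | m₂ | u₀ | u₁ | u₂ | v₀ | v₁ | v₂ = solve-ℕ (m₀ ∷ m₁ ∷ m₂ ∷ u₀ ∷ u₁ ∷ u₂ ∷ v₀ ∷ v₁ ∷ v₂ ∷ [])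

mulVecℕ-indicator : ∀ M b i → mulVecℕ M (indicator b) i ≡ M i b
mulVecℕ-indicator M 0F i with M i 0F | M i 1F | M i 2F
... | m₀ | m₁ | m₂ = solve-ℕ (m₀ ∷ m₁ ∷ m₂ ∷ [])
mulVecℕ-indicator M 1F i with M i 0F | M i 1F | M i 2F
... | m₀ | m₁ | m₂ = solve-ℕ (m₀ ∷ m₁ ∷ m₂ ∷ [])
mulVecℕ-indicator M 2F i with M i 0F | M i 1F | M i 2F
... | m₀ | m₁ | m₂ = solve-ℕ (m₀ ∷ m₁ ∷ m₂ ∷ [])

mulVecℕ-zero : ∀ M i → mulVecℕ M (λ _ → 0) i ≡ 0
mulVecℕ-zero M i with M i 0F | M i 1F | M i 2F
... | m₀ | m₁ | m₂ = solve-ℕ (m₀ ∷ m₁ ∷ m₂ ∷ [])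

ι-mulVec : ∀ M v i → ι (mulVecℕ M v i) ≡ mulVecℚ (toℚMat M) (ι ∘ v) i
ι-mulVec M v i = begin
  ι (M i 0F ℕ.* v 0F ℕ.+ M i 1F ℕ.* v 1F ℕ.+ M i 2F ℕ.* v 2F)
    ≡⟨ trans (ι-+ _ _) (cong (_+ ι (M i 2F ℕ.* v 2F)) (ι-+ _ _)) ⟩
  ι (M i 0F ℕ.* v 0F) + ι (M i 1F ℕ.* v 1F) + ι (M i 2F ℕ.* v 2F)
    ≡⟨ cong₂ _+_ (cong₂ _+_ (ι-* _ _) (ι-* _ _)) (ι-* _ _) ⟩
  (λ j → ι (M i j)) · (ι ∘ v)
    ≡⟨ ·-congˡ (ι ∘ v) (λ j → ι-def (M i j)) ⟩
  toℚMat M i · (ι ∘ v)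
    ∎
  where open ≡-Reasoning

-- Consequences of rationally independent frequencies

nonOrthogonal-or-orthogonalBlocks : ∀ c x n k p →
  (∃[ q ] c · ab x q n ≢ 0ℚ) ⊎ c · ab x p (k ℕ.* n) ≡ 0ℚ
nonOrthogonal-or-orthogonalBlocks c x n zero p =
  inj₂ (trans (·-congʳ c (λ _ → ι-0)) (trans (·-comm c (λ _ → 0ℚ)) (·-zeroˡ c)))
nonOrthogonal-or-orthogonalBlocks c x n (suc k) p =
  step (c · ab x p n ℚₚ.≟ 0ℚ) (nonOrthogonal-or-orthogonalBlocks c x n k (p ℕ.+ n))
  where
  step : Dec (c · ab x p n ≡ 0ℚ) → (∃[ q ] c · ab x q n ≢ 0ℚ) ⊎ c · ab x (p ℕ.+ n) (k ℕ.* n) ≡ 0ℚ →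
         (∃[ q ] c · ab x q n ≢ 0ℚ) ⊎ c · ab x p (n ℕ.+ k ℕ.* n) ≡ 0ℚ
  step (no c·u≢0) _            = inj₁ (p , c·u≢0)
  step (yes _)    (inj₁ found) = inj₁ found
  step (yes c·u≡0) (inj₂ c·v≡0) = inj₂ (begin
    c · ab x p (n ℕ.+ k ℕ.* n)             ≡⟨ ·-congʳ c (ab-++ x p n (k ℕ.* n)) ⟩
    c · (λ a → ab x p n a + v a)           ≡⟨ ·-+ʳ c (ab x p n) v ⟩
    c · ab x p n + c · v                   ≡⟨ cong₂ _+_ c·u≡0 c·v≡0 ⟩
    0ℚ                                     ∎)
    where
    open ≡-Reasoning
    v : ℚ³
    v = ab x (p ℕ.+ n) (k ℕ.* n)

-- If every factor of length n+1 were orthogonal to c, so would be the prefix of length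
-- (N+1)(n+1), and c · freqs x would vanish at an index ≥ N instead of staying ≥ ε.
ratIndep⇒nonOrthogonalFactor : ∀ {x} → RatIndep x → ∀ c → (∃[ a ] c a ≢ 0ℚ) →
  ∀ n → ∃[ q ] c · ab x q (suc n) ≢ 0ℚ
ratIndep⇒nonOrthogonalFactor {x} indep c c≢0 n =
  [ id , (λ orthogonal → ⊥-elim (ℚₚ.<-irrefl refl (ℚₚ.<-≤-trans ε>0 (apart′ orthogonal)))) ]′
    (nonOrthogonal-or-orthogonalBlocks c x (suc n) (suc N) 0)
  where
  bound = indep c c≢0
  ε = proj₁ bound
  ε>0 = proj₁ (proj₂ bound)
  N = proj₁ (proj₂ (proj₂ bound))
  m : ℕ
  m = n ℕ.+ N ℕ.* suc n
  apart : ε ℚ.≤ ∣ c · freqs x m ∣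
  apart = proj₂ (proj₂ (proj₂ bound)) m (ℕₚ.≤-trans (ℕₚ.m≤m*n N (suc n)) (ℕₚ.m≤n+m (N ℕ.* suc n) n))
  apart′ : c · ab x 0 (suc m) ≡ 0ℚ → ε ℚ.≤ 0ℚ
  apart′ orthogonal = subst (λ y → ε ℚ.≤ ∣ y ∣) c·freqs≡0 apart
    where
    instance _ = ι-suc-nonZero m
    c·freqs≡0 : c · freqs x m ≡ 0ℚ
    c·freqs≡0 = *-cancelʳ-≡ (ι (suc m))
      (trans (·-freqs c x m) (trans orthogonal (sym (ℚₚ.*-zeroˡ (ι (suc m))))))

Inequivalent3 : Word → ℕ → ℕ → ℕ → ℕ → Set
Inequivalent3 x n p₁ p₂ p₃ = ¬ AbEq x n p₁ p₂ × ¬ AbEq x n p₁ p₃ × ¬ AbEq x n p₂ p₃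

-- The second factor is separated from the first by a vector orthogonal to the first, the third
-- from both by their cross product.
ratIndep⇒inequivalent3 : ∀ {x} → RatIndep x → ∀ n → ∃[ q₂ ] ∃[ q₃ ] Inequivalent3 x (suc n) 0 q₂ q₃
ratIndep⇒inequivalent3 {x} indep n =
  q₂ , q₃ , 0≁q₂ , separates c₂ (cross-orthˡ u v) c₂·w≢0 , separates c₂ (cross-orthʳ u v) c₂·w≢0
  where
  ab′ : ℕ → ℚ³
  ab′ q = ab x q (suc n)
  u : ℚ³
  u = ab′ 0
  separates : ∀ {p q} c → c · ab′ p ≡ 0ℚ → c · ab′ q ≢ 0ℚ → ¬ AbEq x (suc n) p q
  separates {p} {q} c c·u≡0 c·v≢0 p~q =
    c·v≢0 (trans (·-congʳ c λ a → sym (AbEq⇒ab≗ {x} {suc n} {p} {q} p~q a)) c·u≡0)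
  Σu≢0 : total u ≢ 0ℚ
  Σu≢0 = subst (_≢ 0ℚ) (sym (total-ab x 0 (suc n))) (ι-suc≢0 n)
  orthogonal-to-u : Σ ℚ³ λ c → (∃[ a ] c a ≢ 0ℚ) × c · u ≡ 0ℚ
  orthogonal-to-u = ∃-nonzero-orthogonal u Σu≢0
  c₁ : ℚ³
  c₁ = proj₁ orthogonal-to-u
  c₁-apart : ∃[ q ] c₁ · ab′ q ≢ 0ℚ
  c₁-apart = ratIndep⇒nonOrthogonalFactor indep c₁ (proj₁ (proj₂ orthogonal-to-u)) n
  q₂ : ℕ
  q₂ = proj₁ c₁-apart
  v : ℚ³
  v = ab′ q₂
  same-total : total u ≡ total v
  same-total = trans (total-ab x 0 (suc n)) (sym (total-ab x q₂ (suc n)))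
  0≁q₂ : ¬ AbEq x (suc n) 0 q₂
  0≁q₂ = separates c₁ (proj₂ (proj₂ orthogonal-to-u)) (proj₂ c₁-apart)
  c₂ : ℚ³
  c₂ = cross u v
  c₂≢0 : ∃[ a ] c₂ a ≢ 0ℚ
  c₂≢0 = nonzero-coordinate c₂ λ c₂≗0 →
    0≁q₂ (ab≗⇒AbEq {x} {suc n} {0} {q₂} (cross≗0⇒≗ {u} {v} c₂≗0 same-total Σu≢0))
  c₂-apart : ∃[ q ] c₂ · ab′ q ≢ 0ℚ
  c₂-apart = ratIndep⇒nonOrthogonalFactor indep c₂ c₂≢0 n
  q₃ : ℕ
  q₃ = proj₁ c₂-apart
  c₂·w≢0 : c₂ · ab′ q₃ ≢ 0ℚ
  c₂·w≢0 = proj₂ c₂-apart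

-- At most three abelian classes

-- Vector constructors are only opened locally: overloading the List _∷_ used by solve makes
-- solver calls very slow to elaborate.
module _ where
  open Data.Vec.Relation.Unary.AllPairs using (_∷_)

  allPairs-lookup : ∀ {A : Set} {R : A → A → Set} {m} {xs : Vec A m} {i j : Fin m} →
                    AllPairs R xs → i Fin.< j → R (lookup xs i) (lookup xs j)
  allPairs-lookup {i = zero}  {zero}  _         ()
  allPairs-lookup {i = zero}  {suc j} (Rx ∷ _)  _         = lookup⁺ Rx j
  allPairs-lookup {i = suc _} {zero}  _         ()
  allPairs-lookup {i = suc _} {suc _} (_ ∷ Rxs) (s≤s i<j) = allPairs-lookup Rxs i<j

-- Unlike RhoLe3 this asks for no representatives, so it transfers from w to the induced word.
AtMostThreeClasses : Word → ℕ → Set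
AtMostThreeClasses x n = Σ (ℕ → Fin 3) λ κ → ∀ p q → κ p ≡ κ q → AbEq x n p q

rhoLe3⇒atMostThreeClasses : ∀ {x n} → RhoLe3 x n → AtMostThreeClasses x n
rhoLe3⇒atMostThreeClasses {x} {n} (r₁ , r₂ , r₃ , cover) = proj₁ ∘ classify , same-colour⇒AbEq
  where
  rep : Fin 3 → ℕ
  rep 0F = r₁
  rep 1F = r₂
  rep 2F = r₃
  classify : ∀ q → Σ (Fin 3) λ k → AbEq x n q (rep k)
  classify q with cover q
  ... | inj₁ q~r₁        = 0F , q~r₁
  ... | inj₂ (inj₁ q~r₂) = 1F , q~r₂
  ... | inj₂ (inj₂ q~r₃) = 2F , q~r₃
  same-colour⇒AbEq : ∀ p q → proj₁ (classify p) ≡ proj₁ (classify q) → AbEq x n p q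
  same-colour⇒AbEq p q eq a =
    trans (proj₂ (classify p) a) (trans (cong (λ k → count x (rep k) n a) eq) (sym (proj₂ (classify q) a)))

atMostThreeClasses⇒¬four : ∀ {x n} → AtMostThreeClasses x n →
                           (ps : Vec ℕ 4) → ¬ AllPairs (λ p q → ¬ AbEq x n p q) ps
atMostThreeClasses⇒¬four (κ , same-colour⇒AbEq) ps pairwise
  with i , j , i<j , κᵢ≡κⱼ ← Finₚ.pigeonhole (ℕₚ.n<1+n 3) (κ ∘ lookup ps) =
  allPairs-lookup pairwise i<j (same-colour⇒AbEq _ _ κᵢ≡κⱼ)

atMostThreeClasses⇒Reps3 : ∀ {x n p₁ p₂ p₃} → AtMostThreeClasses x n →
                           Inequivalent3 x n p₁ p₂ p₃ → Reps3 x n p₁ p₂ p₃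
atMostThreeClasses⇒Reps3 {x} {n} {p₁} {p₂} {p₃} classes (p₁≁p₂ , p₁≁p₃ , p₂≁p₃) =
  p₁≁p₂ , p₁≁p₃ , p₂≁p₃ , cover
  where
  cover : ∀ q → AbEq x n q p₁ ⊎ AbEq x n q p₂ ⊎ AbEq x n q p₃
  cover q with abEq? x n q p₁ | abEq? x n q p₂ | abEq? x n q p₃
  ... | yes q~p₁ | _        | _        = inj₁ q~p₁
  ... | no _     | yes q~p₂ | _        = inj₂ (inj₁ q~p₂)
  ... | no _     | no _     | yes q~p₃ = inj₂ (inj₂ q~p₃)
  ... | no q≁p₁  | no q≁p₂  | no q≁p₃  = ⊥-elim (atMostThreeClasses⇒¬four {x} {n} classes
    (q ∷ p₁ ∷ p₂ ∷ p₃ ∷ [])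
    ((q≁p₁ ∷ q≁p₂ ∷ q≁p₃ ∷ []) ∷ (p₁≁p₂ ∷ p₁≁p₃ ∷ []) ∷ (p₂≁p₃ ∷ []) ∷ [] ∷ []))
    where open Data.Vec using (_∷_; [])
          open All using (_∷_; [])
          open Data.Vec.Relation.Unary.AllPairs using (_∷_; [])

-- The abelian induced word

module BlockDecomposition (w : Word) (ℓ p₁ p₂ p₃ : ℕ)
                          (cover : ∀ q → AbEq w ℓ q p₁ ⊎ AbEq w ℓ q p₂ ⊎ AbEq w ℓ q p₃) where

  M : Matℕ
  M = Mell w ℓ p₁ p₂ p₃

  cls : ℕ → Fin 3
  cls = classOf w ℓ p₁ p₂ p₃

  I-from : ℕ → Word
  I-from = inducedFrom w ℓ p₁ p₂ p₃

  count-block : ∀ q i → count w q ℓ i ≡ M i (cls q)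
  count-block q i with abEqᵇ w ℓ q p₁ in q≈p₁
  ... | true = abEqᵇ-sound w ℓ q p₁ q≈p₁ i
  ... | false with abEqᵇ w ℓ q p₂ in q≈p₂
  ... | true = abEqᵇ-sound w ℓ q p₂ q≈p₂ i
  ... | false with cover q
  ... | inj₁ q~p₁        = contradiction (trans (sym q≈p₁) (abEqᵇ-complete w ℓ q p₁ q~p₁)) λ ()
  ... | inj₂ (inj₁ q~p₂) = contradiction (trans (sym q≈p₂) (abEqᵇ-complete w ℓ q p₂ q~p₂)) λ ()
  ... | inj₂ (inj₂ q~p₃) = q~p₃ i

  count-blocks : ∀ n p i → count w p (n ℕ.* ℓ) i ≡ mulVecℕ M (count (I-from p) 0 n) i
  count-blocks zero    p i = sym (mulVecℕ-zero M i)
  count-blocks (suc n) p i = begin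
    count w p (ℓ ℕ.+ n ℕ.* ℓ) i
      ≡⟨ count-++ w p ℓ (n ℕ.* ℓ) i ⟩
    count w p ℓ i ℕ.+ count w (p ℕ.+ ℓ) (n ℕ.* ℓ) i
      ≡⟨ cong₂ ℕ._+_ first-block (count-blocks n (p ℕ.+ ℓ) i) ⟩
    M i (I-from p 0) ℕ.+ mulVecℕ M (count (I-from (p ℕ.+ ℓ)) 0 n) i
      ≡⟨ cong₂ ℕ._+_ (sym (mulVecℕ-indicator M (I-from p 0) i)) (mulVecℕ-cong M i next-block) ⟩
    mulVecℕ M (indicator (I-from p 0)) i ℕ.+ mulVecℕ M (count (I-from p) 1 n) i
      ≡⟨ mulVecℕ-+ M (indicator (I-from p 0)) (count (I-from p) 1 n) i ⟨
    mulVecℕ M (count (I-from p) 0 (suc n)) i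
      ∎
    where
    open ≡-Reasoning
    first-block : count w p ℓ i ≡ M i (I-from p 0)
    first-block = trans (count-block p i) (cong (M i ∘ cls) (sym (ℕₚ.+-identityʳ p)))
    next-block : count (I-from (p ℕ.+ ℓ)) 0 n ≗ count (I-from p) 1 n
    next-block a = count-cong 0 1 n a (λ m → cong cls (ℕₚ.+-assoc p ℓ (m ℕ.* ℓ)))

module InducedWord (w : Word) (hasFreqs : HasFreqs w) (indep : RatIndep w)
            (l p₁ p₂ p₃ : ℕ) (reps : Reps3 w (suc l) p₁ p₂ p₃) where

  ℓ : ℕ
  ℓ = suc l

  open BlockDecomposition w ℓ p₁ p₂ p₃ (proj₂ (proj₂ (proj₂ reps))) public

  Mq : Matℚ
  Mq = toℚMat M

  I : Word
  I = induced w ℓ p₁ p₂ p₃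

  end : ℕ → ℕ
  end n = l ℕ.+ n ℕ.* ℓ

  n≤end : ∀ n → n ≤ end n
  n≤end n = ℕₚ.≤-trans (ℕₚ.m≤m*n n ℓ) (ℕₚ.m≤n+m (n ℕ.* ℓ) l)

  ab-block : ∀ q → ab w q ℓ ≗ transpose Mq (cls q)
  ab-block q i = trans (cong ι (count-block q i)) (ι-def (M i (cls q)))

  ab-blocks : ∀ n p → ab w p (n ℕ.* ℓ) ≗ mulVecℚ Mq (ab (I-from p) 0 n)
  ab-blocks n p i = trans (cong ι (count-blocks n p i)) (ι-mulVec M (count (I-from p) 0 n) i)

  first-columns-independent : ¬ (∀ a → cross (transpose Mq 0F) (transpose Mq 1F) a ≡ 0ℚ)
  first-columns-independent cross≗0 = proj₁ reps (ab≗⇒AbEq {w} {ℓ} {p₁} {p₂} λ i → begin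
    ab w p₁ ℓ i            ≡⟨ column₁ i ⟩
    transpose Mq 0F i      ≡⟨ cross≗0⇒≗ {transpose Mq 0F} {transpose Mq 1F} cross≗0 same-total Σ≢0 i ⟩
    transpose Mq 1F i      ≡⟨ column₂ i ⟨
    ab w p₂ ℓ i            ∎)
    where
    column₁ : ab w p₁ ℓ ≗ transpose Mq 0F
    column₁ i = ι-def (count w p₁ ℓ i)
    column₂ : ab w p₂ ℓ ≗ transpose Mq 1F
    column₂ i = ι-def (count w p₂ ℓ i)
    open ≡-Reasoning
    total-of : ∀ p u → ab w p ℓ ≗ u → total u ≡ ι ℓ
    total-of p u eq = trans (sym (total-cong {ab w p ℓ} {u} eq)) (total-ab w p ℓ)
    same-total : total (transpose Mq 0F) ≡ total (transpose Mq 1F)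
    same-total = trans (total-of p₁ (transpose Mq 0F) column₁) (sym (total-of p₂ (transpose Mq 1F) column₂))
    Σ≢0 : total (transpose Mq 0F) ≢ 0ℚ
    Σ≢0 = subst (_≢ 0ℚ) (sym (total-of p₁ (transpose Mq 0F) column₁)) (ι-suc≢0 l)

  det≢0 : det Mq ≢ 0ℚ
  det≢0 det≡0 = proj₂ witness (begin
    c · ab w q ℓ                  ≡⟨ ·-congʳ c (ab-block q) ⟩
    c · transpose Mq (cls q)      ≡⟨ adj-mul Mq 2F (cls q) ⟩
    idMat 2F (cls q) * det Mq     ≡⟨ cong (idMat 2F (cls q) *_) det≡0 ⟩
    idMat 2F (cls q) * 0ℚ         ≡⟨ ℚₚ.*-zeroʳ (idMat 2F (cls q)) ⟩
    0ℚ                            ∎)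
    where
    open ≡-Reasoning
    c : ℚ³
    c = adj Mq 2F
    witness : ∃[ q ] c · ab w q ℓ ≢ 0ℚ
    witness = ratIndep⇒nonOrthogonalFactor indep c (nonzero-coordinate c first-columns-independent) l
    q : ℕ
    q = proj₁ witness

  Mq-invertible : InGL3ℚ Mq
  Mq-invertible = det≢0⇒InGL3ℚ Mq det≢0

  N : Matℚ
  N = proj₁ Mq-invertible

  NM≡I : ∀ i j → mulMat N Mq i j ≡ idMat i j
  NM≡I = proj₂ (proj₂ Mq-invertible)

  ℓ⁻¹ : ℚ
  ℓ⁻¹ = + 1 / ℓ

  ℓ⁻¹*ℓ≡1 : ℓ⁻¹ * ι ℓ ≡ 1ℚ
  ℓ⁻¹*ℓ≡1 = trans (/-*-cancelʳ 1 l) ι-1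

  freqs-blocks : ∀ n → freqs w (end n) ≗ λ i → ℓ⁻¹ * mulVecℚ Mq (freqs I n) i
  freqs-blocks n i = *-cancelʳ-≡ (ι (suc (end n))) (begin
    freqSeq w i (end n) * ι (suc (end n))   ≡⟨ /-*-cancelʳ (count w 0 (suc (end n)) i) (end n) ⟩
    ab w 0 (suc n ℕ.* ℓ) i                   ≡⟨ ab-blocks (suc n) 0 i ⟩
    Mq i · ab I 0 (suc n)                    ≡⟨ ·-freqs (Mq i) I n ⟨
    y * ι (suc n)                            ≡⟨ ℚₚ.*-identityʳ (y * ι (suc n)) ⟨
    y * ι (suc n) * 1ℚ                       ≡⟨ cong (y * ι (suc n) *_) ℓ⁻¹*ℓ≡1 ⟨
    y * ι (suc n) * (ℓ⁻¹ * ι ℓ)              ≡⟨ regroup ℓ⁻¹ y (ι (suc n)) (ι ℓ) ⟩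
    ℓ⁻¹ * y * (ι (suc n) * ι ℓ)              ≡⟨ cong (ℓ⁻¹ * y *_) (ι-* (suc n) ℓ) ⟨
    ℓ⁻¹ * y * ι (suc (end n))                ∎)
    where
    open ≡-Reasoning
    instance _ = ι-suc-nonZero (end n)
    y : ℚ
    y = Mq i · freqs I n
    regroup : ∀ a b c d → b * c * (a * d) ≡ a * b * (c * d)
    regroup a b c d = solve (a ∷ b ∷ c ∷ d ∷ []) ℚ-ring

  sameLimit-freqs : ∀ i → SameLimit (freqSeq w i) (λ n → ℓ⁻¹ * mulVecℚ Mq (freqs I n) i)
  sameLimit-freqs i = SameLimit-congʳ {freqSeq w i} (λ n → freqs-blocks n i)
    (Converges⇒SameLimit-subsequence {freqSeq w i} end n≤end (hasFreqs i))

  freqs-induced : ∀ n → freqs I n ≗ λ a → ι ℓ * mulVecℚ N (freqs w (end n)) a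
  freqs-induced n a = sym (begin
    ι ℓ * (N a · freqs w (end n))                ≡⟨ cong (ι ℓ *_) (·-congʳ (N a) (freqs-blocks n)) ⟩
    ι ℓ * (N a · (λ i → ℓ⁻¹ * mulVecℚ Mq f i))   ≡⟨ cong (ι ℓ *_) (·-*ˡ ℓ⁻¹ (N a) (mulVecℚ Mq f)) ⟩
    ι ℓ * (ℓ⁻¹ * mulVecℚ N (mulVecℚ Mq f) a)     ≡⟨ cong (λ y → ι ℓ * (ℓ⁻¹ * y)) (N-Mq-cancel f a) ⟩
    ι ℓ * (ℓ⁻¹ * f a)                            ≡⟨ ℚₚ.*-assoc (ι ℓ) ℓ⁻¹ (f a) ⟨
    ι ℓ * ℓ⁻¹ * f a                              ≡⟨ cong (_* f a) (trans (ℚₚ.*-comm (ι ℓ) ℓ⁻¹) ℓ⁻¹*ℓ≡1) ⟩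
    1ℚ * f a                                     ≡⟨ ℚₚ.*-identityˡ (f a) ⟩
    f a                                          ∎)
    where
    open ≡-Reasoning
    f : ℚ³
    f = freqs I n
    N-Mq-cancel : ∀ u a → mulVecℚ N (mulVecℚ Mq u) a ≡ u a
    N-Mq-cancel = mulVec-leftInverse N Mq NM≡I

  hasFreqs-I : HasFreqs I
  hasFreqs-I a =
    Converges-cong {λ n → ι ℓ * mulVecℚ N (freqs w (end n)) a} (λ n → sym (freqs-induced n a))
    (Converges-*ˡ (ι ℓ) (Converges-· (N a) {λ i n → freqSeq w i (end n)}
      (λ i → Converges-subsequence {freqSeq w i} end n≤end (hasFreqs i))))

  ratIndep-I : RatIndep I
  ratIndep-I c (a , ca≢0) = ε , ε>0 , N₀ , λ n n≥N₀ → begin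
    ε                                  ≤⟨ apart (end n) (ℕₚ.≤-trans n≥N₀ (n≤end n)) ⟩
    ∣ d · freqs w (end n) ∣            ≤⟨ ∣p∣≤∣q*p∣ (d · freqs w (end n)) (1≤ι-suc l) ⟩
    ∣ ι ℓ * (d · freqs w (end n)) ∣    ≡⟨ cong ∣_∣ (c·freqs-induced n) ⟨
    ∣ c · freqs I n ∣                  ∎
    where
    open ℚₚ.≤-Reasoning
    d : ℚ³
    d = mulVecℚ (transpose N) c
    d≢0 : ¬ (∀ i → d i ≡ 0ℚ)
    d≢0 d≗0 = ca≢0 (begin-equality
      c a                                ≡⟨ ·-idMat a c ⟨
      c · (λ k → idMat k a)              ≡⟨ ·-congʳ c (λ k → NM≡I k a) ⟨
      c · mulVecℚ N (transpose Mq a)     ≡⟨ ·-mulVec c N (transpose Mq a) ⟩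
      d · transpose Mq a                 ≡⟨ ·-congˡ (transpose Mq a) d≗0 ⟩
      (λ _ → 0ℚ) · transpose Mq a        ≡⟨ ·-zeroˡ (transpose Mq a) ⟩
      0ℚ                                 ∎)
    bound = indep d (nonzero-coordinate d d≢0)
    ε = proj₁ bound
    ε>0 = proj₁ (proj₂ bound)
    N₀ = proj₁ (proj₂ (proj₂ bound))
    apart = proj₂ (proj₂ (proj₂ bound))
    c·freqs-induced : ∀ n → c · freqs I n ≡ ι ℓ * (d · freqs w (end n))
    c·freqs-induced n = begin-equality
      c · freqs I n                                    ≡⟨ ·-congʳ c (freqs-induced n) ⟩
      c · (λ a → ι ℓ * mulVecℚ N (freqs w (end n)) a)  ≡⟨ ·-*ˡ (ι ℓ) c (mulVecℚ N (freqs w (end n))) ⟩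
      ι ℓ * (c · mulVecℚ N (freqs w (end n)))          ≡⟨ cong (ι ℓ *_) (·-mulVec c N (freqs w (end n))) ⟩
      ι ℓ * (d · freqs w (end n))                      ∎

  AbEq-induced : ∀ n p q → AbEq w (n ℕ.* ℓ) (p ℕ.* ℓ) (q ℕ.* ℓ) → AbEq I n p q
  AbEq-induced n p q blocks~ = ab≗⇒AbEq {I} {n} {p} {q} (mulVec-injective N Mq NM≡I λ i → begin
    mulVecℚ Mq (ab I p n) i        ≡⟨ ab-blocks′ p i ⟨
    ab w (p ℕ.* ℓ) (n ℕ.* ℓ) i     ≡⟨ AbEq⇒ab≗ {w} {n ℕ.* ℓ} {p ℕ.* ℓ} {q ℕ.* ℓ} blocks~ i ⟩
    ab w (q ℕ.* ℓ) (n ℕ.* ℓ) i     ≡⟨ ab-blocks′ q i ⟩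
    mulVecℚ Mq (ab I q n) i        ∎)
    where
    open ≡-Reasoning
    ab-blocks′ : ∀ p → ab w (p ℕ.* ℓ) (n ℕ.* ℓ) ≗ mulVecℚ Mq (ab I p n)
    ab-blocks′ p i = trans (ab-blocks n (p ℕ.* ℓ) i) (·-congʳ (Mq i) λ a →
      cong ι (count-cong {I-from (p ℕ.* ℓ)} {I} 0 p n a λ m → cong cls (sym (ℕₚ.*-distribʳ-+ ℓ p m))))

  atMostThreeClasses-induced : ∀ n → AtMostThreeClasses w (n ℕ.* ℓ) → AtMostThreeClasses I n
  atMostThreeClasses-induced n (κ , same-colour⇒AbEq) =
    (λ p → κ (p ℕ.* ℓ)) , λ p q eq → AbEq-induced n p q (same-colour⇒AbEq (p ℕ.* ℓ) (q ℕ.* ℓ) eq)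

  rho≡3-I : (∀ n → 1 ≤ n → RhoLe3 w n) → ∀ n → 1 ≤ n → Rho≡3 I n
  rho≡3-I ρ≤3 (suc n) _ = reps3 (ratIndep⇒inequivalent3 ratIndep-I n)
    where
    classes : AtMostThreeClasses I (suc n)
    classes = atMostThreeClasses-induced (suc n)
      (rhoLe3⇒atMostThreeClasses {w} {suc n ℕ.* ℓ} (ρ≤3 (suc n ℕ.* ℓ) (s≤s z≤n)))
    reps3 : ∃[ q₂ ] ∃[ q₃ ] Inequivalent3 I (suc n) 0 q₂ q₃ → Rho≡3 I (suc n)
    reps3 (q₂ , q₃ , inequivalent) = 0 , q₂ , q₃ , atMostThreeClasses⇒Reps3 {I} {suc n} classes inequivalent

lemma16 : (w : Word) → (∀ n → 1 ≤ n → RhoLe3 w n) → HasFreqs w → RatIndep w →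
    (ℓ : ℕ) → .{{_ : NonZero ℓ}} → (p₁ p₂ p₃ : ℕ) → Reps3 w ℓ p₁ p₂ p₃ →
    (∀ n p → 1 ≤ n → (i : Fin 3) →
      count w p (n Data.Nat.* ℓ) i
        ≡ mulVecℕ (Mell w ℓ p₁ p₂ p₃) (count (inducedFrom w ℓ p₁ p₂ p₃ p) 0 n) i)
    × (HasFreqs (induced w ℓ p₁ p₂ p₃) → ∀ (i : Fin 3) →
        SameLimit (freqSeq w i)
          (λ n → (+ 1 / ℓ) * mulVecℚ (toℚMat (Mell w ℓ p₁ p₂ p₃))
                               (λ a → freqSeq (induced w ℓ p₁ p₂ p₃) a n) i))
    × InGL3ℚ (toℚMat (Mell w ℓ p₁ p₂ p₃))
    × (HasFreqs (induced w ℓ p₁ p₂ p₃) × RatIndep (induced w ℓ p₁ p₂ p₃))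
    × (∀ n → 1 ≤ n → Rho≡3 (induced w ℓ p₁ p₂ p₃) n)
lemma16 w ρ≤3 hasFreqs indep (suc l) p₁ p₂ p₃ reps =
    (λ n p _ → count-blocks n p)
  , (λ _ → sameLimit-freqs)
  , Mq-invertible
  , (hasFreqs-I , ratIndep-I)
  , rho≡3-I ρ≤3
  where open InducedWord w hasFreqs indep l p₁ p₂ p₃ reps
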